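{- Every $\mathfrak{F}$-Cayley colour integral finite group is normal Cayley integral.
   Context: For a finite group $G$ and $f:G\to\mathbb{C}$ with $f(g)=f(g^{ -1})$, the Cayley colour graph $\operatorname{Cay}(G,f)$ has adjacency matrix $[f(gh^{ -1})]_{g,h\in G}$ and is integral if all its eigenvalues are integers. $G$ is $\mathfrak{F}$-Cayley colour integral if $\operatorname{Cay}(G,f)$ is integral for every class function $f:G\to\mathbb{Z}$ with $f(g)=f(g^{ -1})$ for all $g\in G$. For an inverse-closed $S\subseteq G\setminus\{1\}$, the Cayley graph $\operatorname{Cay}(G,S)$ has vertex set $G$ with $u\ne v$ adjacent iff $uv^{ -1}\in S$; it is normal if $gSg^{ -1}=S$ for all $g\in G$. $G$ is normal Cayley integral if every normal Cayley graph on $G$ has only integer adjacency eigenvalues. -}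

module Defs where

open import Data.Nat using (ℕ; zero; suc)
open import Data.Fin using (Fin; zero; suc; punchIn)
open import Data.Fin.Properties using (_≟_)
open import Data.Integer using (ℤ; +_; -[1+_]) renaming (_+_ to _+ℤ_; _*_ to _*ℤ_; -_ to -ℤ_)
open import Data.List using (List; []; _∷_)
open import Data.Bool using (Bool; true; false; if_then_else_)
open import Data.Product using (Σ; _×_)
open import Relation.Binary.PropositionalEquality using (_≡_)
open import Relation.Nullary using (does)
open import Algebra.Structures using (IsGroup)

-- Polynomials over ℤ as coefficient lists (lowest degree first)

Poly : Set
Poly = List ℤ

coeff : Poly → ℕ → ℤ
coeff []       _       = + 0
coeff (a ∷ p) zero    = a
coeff (a ∷ p) (suc k) = coeff p k

_≈ₚ_ : Poly → Poly → Set
p ≈ₚ q = ∀ k → coeff p k ≡ coeff q k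

_+ₚ_ : Poly → Poly → Poly
[]      +ₚ q       = q
(a ∷ p) +ₚ []      = a ∷ p
(a ∷ p) +ₚ (b ∷ q) = (a +ℤ b) ∷ (p +ₚ q)

scaleₚ : ℤ → Poly → Poly
scaleₚ c []      = []
scaleₚ c (a ∷ p) = (c *ℤ a) ∷ scaleₚ c p

_*ₚ_ : Poly → Poly → Poly
[]      *ₚ q = []
(a ∷ p) *ₚ q = scaleₚ a q +ₚ (+ 0 ∷ (p *ₚ q))

negₚ : Poly → Poly
negₚ = scaleₚ (-[1+ 0 ])

constₚ : ℤ → Poly
constₚ c = c ∷ []

Xₚ : Poly
Xₚ = + 0 ∷ + 1 ∷ []

sumFin : (n : ℕ) → (Fin n → Poly) → Poly
sumFin zero    f = []
sumFin (suc n) f = f zero +ₚ sumFin n (λ i → f (suc i))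

sign : ℕ → Poly → Poly
sign zero          p = p
sign (suc zero)    p = negₚ p
sign (suc (suc k)) p = sign k p

toℕ' : {n : ℕ} → Fin n → ℕ
toℕ' zero    = zero
toℕ' (suc i) = suc (toℕ' i)

det : (n : ℕ) → (Fin n → Fin n → Poly) → Poly
det zero    M = constₚ (+ 1)
det (suc n) M =
  sumFin (suc n) (λ j → sign (toℕ' j)
    (M zero j *ₚ det n (λ i k → M (suc i) (punchIn j k))))

charPoly : (n : ℕ) → (Fin n → Fin n → ℤ) → Poly
charPoly n A = det n (λ i j →
  (if does (i ≟ j) then Xₚ else []) +ₚ negₚ (constₚ (A i j)))

prodFin : (n : ℕ) → (Fin n → Poly) → Poly
prodFin zero    f = constₚ (+ 1)
prodFin (suc n) f = f zero *ₚ prodFin n (λ i → f (suc i))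

-- A matrix is integral iff all its eigenvalues (the roots, with multiplicity,
-- of its characteristic polynomial) are integers, i.e. the characteristic
-- polynomial factors as ∏ (x - λᵢ) with λᵢ ∈ ℤ.
IntegralMatrix : (n : ℕ) → (Fin n → Fin n → ℤ) → Set
IntegralMatrix n A =
  Σ (Fin n → ℤ) λ λs →
    charPoly n A ≈ₚ prodFin n (λ i → Xₚ +ₚ negₚ (constₚ (λs i)))

record FinGroup : Set where
  field
    order   : ℕ
    _∙_     : Fin order → Fin order → Fin order
    ε       : Fin order
    _⁻¹     : Fin order → Fin order
    isGroup : IsGroup _≡_ _∙_ ε _⁻¹

module _ (G : FinGroup) where
  open FinGroup G

  IsSymClassFunction : (Fin order → ℤ) → Set
  IsSymClassFunction f =
    (∀ g h → f ((h ∙ g) ∙ (h ⁻¹)) ≡ f g) × (∀ g → f g ≡ f (g ⁻¹))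

  cayColourMatrix : (Fin order → ℤ) → Fin order → Fin order → ℤ
  cayColourMatrix f g h = f (g ∙ (h ⁻¹))

  FCayleyColourIntegral : Set
  FCayleyColourIntegral =
    ∀ (f : Fin order → ℤ) → IsSymClassFunction f →
      IntegralMatrix order (cayColourMatrix f)

  IsNormalConnectionSet : (Fin order → Bool) → Set
  IsNormalConnectionSet S =
    (S ε ≡ false) ×
    (∀ g → S g ≡ S (g ⁻¹)) ×
    (∀ g s → S ((g ∙ s) ∙ (g ⁻¹)) ≡ S s)

  cayleyAdj : (Fin order → Bool) → Fin order → Fin order → ℤ
  cayleyAdj S u v =
    if does (u ≟ v) then + 0 else (if S (u ∙ (v ⁻¹)) then + 1 else + 0)

  NormalCayleyIntegral : Set
  NormalCayleyIntegral =
    ∀ (S : Fin order → Bool) → IsNormalConnectionSet S →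
      IntegralMatrix order (cayleyAdj S)

{-# OPTIONS --safe #-}
module Submission where

-- The indicator function of a normal connection set S is a symmetric class
-- function, and because 1 ∉ S its colour graph has no loops, so it is exactly
-- the Cayley graph Cay(G, S).

open import Defs
open import Data.Nat using (zero; suc)
open import Data.Fin using (Fin; zero; suc; punchIn)
open import Data.Fin.Properties using (_≟_)
open import Data.Integer using (ℤ; +_)
open import Data.Bool using (Bool; false; if_then_else_)
open import Data.List using ([])
open import Data.Product using (_,_)
open import Function using (_∘_)
open import Relation.Binary.PropositionalEquality
  using (_≡_; refl; sym; trans; cong; cong₂; module ≡-Reasoning)
open import Relation.Nullary using (does; yes; no)
open import Algebra.Structures using (IsGroup)

sumFin-cong : ∀ n {f g : Fin n → Poly} → (∀ i → f i ≡ g i) → sumFin n f ≡ sumFin n g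
sumFin-cong zero    f≗g = refl
sumFin-cong (suc n) f≗g = cong₂ _+ₚ_ (f≗g zero) (sumFin-cong n (f≗g ∘ suc))

det-cong : ∀ n {M N : Fin n → Fin n → Poly} →
           (∀ i j → M i j ≡ N i j) → det n M ≡ det n N
det-cong zero    M≗N = refl
det-cong (suc n) M≗N = sumFin-cong (suc n) λ j →
  cong₂ (λ a d → sign (toℕ' j) (a *ₚ d))
        (M≗N zero j)
        (det-cong n λ i k → M≗N (suc i) (punchIn j k))

charPoly-cong : ∀ n {A B : Fin n → Fin n → ℤ} →
                (∀ i j → A i j ≡ B i j) → charPoly n A ≡ charPoly n B
charPoly-cong n A≗B = det-cong n λ i j →
  cong (λ a → (if does (i ≟ j) then Xₚ else []) +ₚ negₚ (constₚ a)) (A≗B i j)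

IntegralMatrix-resp : ∀ n {A B : Fin n → Fin n → ℤ} →
                      (∀ i j → A i j ≡ B i j) → IntegralMatrix n B → IntegralMatrix n A
IntegralMatrix-resp n A≗B (λs , χB≈∏) =
  λs , λ k → trans (cong (λ p → coeff p k) (charPoly-cong n A≗B)) (χB≈∏ k)

indicator : Bool → ℤ
indicator b = if b then + 1 else + 0

module _ (G : FinGroup) where
  open FinGroup G
  open IsGroup isGroup using (inverseʳ)

  indicator-isSymClassFunction : ∀ S → IsNormalConnectionSet G S →
                                 IsSymClassFunction G (indicator ∘ S)
  indicator-isSymClassFunction S (_ , S-inv , S-conj) =
    (λ g h → cong indicator (S-conj h g)) , (λ g → cong indicator (S-inv g))

  cayleyAdj≗cayColourMatrix : ∀ S → S ε ≡ false → ∀ u v →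
                              cayleyAdj G S u v ≡ cayColourMatrix G (indicator ∘ S) u v
  cayleyAdj≗cayColourMatrix S S-ε u v with u ≟ v
  ... | no _     = refl
  ... | yes refl = sym (begin
    indicator (S (u ∙ (u ⁻¹))) ≡⟨ cong (indicator ∘ S) (inverseʳ u) ⟩
    indicator (S ε)            ≡⟨ cong indicator S-ε ⟩
    + 0                        ∎)
    where open ≡-Reasoning

mainTheorem12 : (G : FinGroup) → FCayleyColourIntegral G → NormalCayleyIntegral G
mainTheorem12 G colourIntegral S S-normal@(S-ε , _) =
  IntegralMatrix-resp (FinGroup.order G)
    (cayleyAdj≗cayColourMatrix G S S-ε)
    (colourIntegral (indicator ∘ S) (indicator-isSymClassFunction G S S-normal))
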